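{- Let $(X,\mathcal{R})$ be a $d$-class association scheme with intersection numbers $p_{i,j}^k$, let $\Pi$ be an equitable partition of $(X,\mathcal{R})$ with $n$ cells all of the same size $|X|/n$, and let $p$ be a prime. For $i\in\{0,\dots,d\}$ let $M_i$ be the $n\times n$ quotient matrix of the graph $\Gamma_i$ with respect to $\Pi$. If for some fixed $i\in\{1,2,\dots,d\}$ the prime $p$ divides $p_{i,i}^k$ for all $k\in\{0,1,\dots,d\}$, then the rows of $M_i$ (with entries reduced modulo $p$) span a self-orthogonal linear code of length $n$ over $\mathbb{F}_q$, where $q=p^m$ for any positive integer $m$.
   Context: An association scheme with $d$ classes is a pair $(X,\mathcal{R})$ where $X$ is a finite set and $\mathcal{R}=\{R_0,\dots,R_d\}$ is a partition of $X\times X$ such that $R_0=\{(x,x):x\in X\}$, each $R_i$ is symmetric, and there are numbers $p_{i,j}^k$ such that for every $(x,y)\in R_k$ the number of $z\in X$ with $(x,z)\in R_i$ and $(z,y)\in R_j$ equals $p_{i,j}^k$. $\Gamma_i$ is the graph on $X$ whose adjacency matrix $A_i$ has $[A_i]_{xy}=1$ iff $(x,y)\in R_i$. A partition of the vertex set of a graph into cells $C_0,\dots,C_{n-1}$ is equitable if for all $a,b$ every vertex in $C_a$ has the same number $b_{a,b}$ of neighbours in $C_b$; $(b_{a,b})$ is the quotient matrix. An equitable partition of $(X,\mathcal{R})$ is one that is equitable for every $\Gamma_i$. A linear code $C\subseteq\mathbb{F}_q^n$ is self-orthogonal if $C\subseteq C^\perp$ with respect to the standard inner product. -}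

module Defs where

open import Level using (Level; _⊔_)
open import Data.Nat using (ℕ; zero; suc)
open import Data.Fin using (Fin; zero; suc; _≟_)
open import Data.List using (List; length; filter; allFin)
open import Data.Product using (Σ; ∃; _×_; _,_)
open import Relation.Nullary using (¬_; Dec)
open import Relation.Nullary.Decidable using (_×-dec_)
open import Relation.Unary using (Pred; Decidable)
open import Relation.Binary.PropositionalEquality using (_≡_)
open import Algebra.Bundles using (CommutativeRing)

count : ∀ {N : ℕ} {ℓ : Level} {P : Pred (Fin N) ℓ} → Decidable P → ℕ
count {N} P? = length (filter P? (allFin N))

-- Association schemes on X = Fin N with classes R_0,…,R_d, encoded by
-- the function R x y = the index i with (x,y) ∈ R_i.

record IsAssociationScheme (N d : ℕ) (R : Fin N → Fin N → Fin (suc d))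
                           (pp : Fin (suc d) → Fin (suc d) → Fin (suc d) → ℕ) : Set where
  field
    diagonal  : ∀ x y → R x y ≡ zero → x ≡ y
    diagonal′ : ∀ x → R x x ≡ zero
    symmetric : ∀ x y → R x y ≡ R y x
    nonempty  : ∀ i → Σ (Fin N) λ x → Σ (Fin N) λ y → R x y ≡ i
    intersection : ∀ i j x y →
      count (λ z → (R x z ≟ i) ×-dec (R z y ≟ j)) ≡ pp i j (R x y)

-- Π : Fin N → Fin n assigns each vertex its cell; M i a b is the quotient
-- matrix of Γ_i: every vertex x in cell a has exactly M i a b neighbours
-- (in Γ_i) in cell b.
IsEquitableWithQuotients : (N d n : ℕ) (R : Fin N → Fin N → Fin (suc d))
  (Π : Fin N → Fin n) (M : Fin (suc d) → Fin n → Fin n → ℕ) → Set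
IsEquitableWithQuotients N d n R Π M =
  ∀ i x b → count (λ z → (R x z ≟ i) ×-dec (Π z ≟ b)) ≡ M i (Π x) b

AllCellsOfSize : (N n : ℕ) (Π : Fin N → Fin n) (c : ℕ) → Set
AllCellsOfSize N n Π c = ∀ a → count (λ z → Π z ≟ a) ≡ c

module _ {c ℓ : Level} (F : CommutativeRing c ℓ) where
  open CommutativeRing F using (Carrier; _≈_; _+_; _*_; 0#; 1#)

  record IsField : Set (c ⊔ ℓ) where
    field
      1≉0     : ¬ (1# ≈ 0#)
      inverse : ∀ x → ¬ (x ≈ 0#) → Σ Carrier λ y → (x * y) ≈ 1#

  record HasCardinality (q : ℕ) : Set (c ⊔ ℓ) where
    field
      enum       : Fin q → Carrier
      injective  : ∀ i j → enum i ≈ enum j → i ≡ j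
      surjective : ∀ x → Σ (Fin q) λ i → enum i ≈ x

  -- canonical map ℕ → F (n ↦ n·1); this is reduction mod char F
  ι : ℕ → Carrier
  ι zero    = 0#
  ι (suc k) = 1# + ι k

  Σ[_] : ∀ {n} → (Fin n → Carrier) → Carrier
  Σ[_] {zero}  f = 0#
  Σ[_] {suc n} f = f zero + Σ[_] (λ j → f (suc j))

  ⟨_,_⟩ : ∀ {n} → (Fin n → Carrier) → (Fin n → Carrier) → Carrier
  ⟨ u , v ⟩ = Σ[ (λ j → u j * v j) ]

  InRowSpan : ∀ {k n} → (Fin k → Fin n → Carrier) → (Fin n → Carrier) → Set (c ⊔ ℓ)
  InRowSpan {k} {n} G v =
    Σ (Fin k → Carrier) λ λs → ∀ j → v j ≈ Σ[ (λ a → λs a * G a j) ]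

  RowSpanSelfOrthogonal : ∀ {k n} → (Fin k → Fin n → Carrier) → Set (c ⊔ ℓ)
  RowSpanSelfOrthogonal G =
    ∀ u v → InRowSpan G u → InRowSpan G v → ⟨ u , v ⟩ ≈ 0#

-- Reduction mod p is the ring map ι : ℕ → F, and ι p ≈ 0 because the additive group of F has
-- order p^m and F has no zero divisors.  So it suffices that p divide every row inner product
-- Σ_j (M_i)_{rj} (M_i)_{sj} of the integer matrix M_i.  Double counting the Γ_i-edges between two
-- cells of equal size shows M_i is symmetric, so these are the entries of M_i², and the
-- vertex-wise computation M_i M_j = Σ_k p_{ij}^k M_k (valid because every cell is nonempty)
-- makes them combinations of the p_{ii}^k.

module Submission where

open import Level using (Level)
open import Data.Nat using (ℕ; suc; _^_; NonZero)
open import Data.Nat.Divisibility using (_∣_)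
open import Data.Nat.Primality using (Prime)
open import Data.Fin using (Fin; zero; suc)
open import Algebra.Bundles using (CommutativeRing)
open import Defs

module FiniteFieldCodes {a ℓ} (F : CommutativeRing a ℓ) where
  open import Data.Nat using (zero) renaming (_+_ to _+ℕ_; _*_ to _*ℕ_)
  open import Data.Nat.Properties using (+-*-semiring)
  open import Data.Nat.Divisibility using (divides)
  open import Data.Fin.Properties using () renaming (_≟_ to _≟ᶠ_)
  open import Data.Fin.Permutation using (Permutation′; permutation)
  open import Data.Product using (_,_; proj₁; proj₂)
  open import Data.Empty using (⊥-elim)
  open import Relation.Nullary using (Dec; yes; no; ¬_)
  open import Relation.Nullary.Decidable using (map′)
  open import Relation.Binary.PropositionalEquality as ≡ using (_≡_)
  import Algebra.Properties.Semiring.Sum +-*-semiring as ℕΣ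
  open CommutativeRing F hiding (zero)
  open import Algebra.Properties.Semiring.Sum semiring
  open import Algebra.Properties.Semiring.Mult semiring
  open import Algebra.Properties.Group +-group using (identityʳ-unique)
  open import Relation.Binary.Reasoning.Setoid setoid

  Σ≡sum : ∀ {n} (f : Fin n → Carrier) → Σ[_] F f ≡ sum f
  Σ≡sum {zero}  f = ≡.refl
  Σ≡sum {suc n} f = ≡.cong (f zero +_) (Σ≡sum (λ j → f (suc j)))

  ι≡×1# : ∀ k → ι F k ≡ k × 1#
  ι≡×1# zero    = ≡.refl
  ι≡×1# (suc k) = ≡.cong (1# +_) (ι≡×1# k)

  ι-homo-+ : ∀ m n → ι F (m +ℕ n) ≈ ι F m + ι F n
  ι-homo-+ m n rewrite ι≡×1# (m +ℕ n) | ι≡×1# m | ι≡×1# n = ×-homo-+ 1# m n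

  ι-homo-* : ∀ m n → ι F (m *ℕ n) ≈ ι F m * ι F n
  ι-homo-* m n rewrite ι≡×1# (m *ℕ n) | ι≡×1# m | ι≡×1# n = ×1-homo-* m n

  ι-homo-∑ : ∀ {n} (f : Fin n → ℕ) → ι F (ℕΣ.sum f) ≈ sum (λ j → ι F (f j))
  ι-homo-∑ {zero}  f = refl
  ι-homo-∑ {suc n} f = trans (ι-homo-+ (f zero) _) (+-congˡ (ι-homo-∑ (λ j → f (suc j))))

  ι-∣ : ∀ {p k} → ι F p ≈ 0# → p ∣ k → ι F k ≈ 0#
  ι-∣ {p} ιp≈0 (divides t ≡.refl) = begin
    ι F (t *ℕ p)    ≈⟨ ι-homo-* t p ⟩
    ι F t * ι F p   ≈⟨ *-congˡ ιp≈0 ⟩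
    ι F t * 0#      ≈⟨ zeroʳ _ ⟩
    0#              ∎

  ⟨⟩-comm : ∀ {n} (u v : Fin n → Carrier) → ⟨_,_⟩ F u v ≈ ⟨_,_⟩ F v u
  ⟨⟩-comm u v rewrite Σ≡sum (λ j → u j * v j) | Σ≡sum (λ j → v j * u j) =
    sum-cong-≋ (λ j → *-comm (u j) (v j))

  ⟨⟩-rowSpan : ∀ {k n} (G : Fin k → Fin n → Carrier) {u v} →
               InRowSpan F G u → (∀ r → ⟨_,_⟩ F (G r) v ≈ 0#) → ⟨_,_⟩ F u v ≈ 0#
  ⟨⟩-rowSpan {k} {n} G {u} {v} (λs , u≈Σ) G⊥v rewrite Σ≡sum (λ j → u j * v j) = begin
    ∑[ j < n ] (u j * v j)                        ≈⟨ sum-cong-≋ (λ j → *-congʳ (u≈∑ j)) ⟩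
    ∑[ j < n ] (∑[ r < k ] (λs r * G r j) * v j)  ≈⟨ sum-cong-≋ (λ j → *-distribʳ-sum (v j) (λ r → λs r * G r j)) ⟩
    ∑[ j < n ] ∑[ r < k ] (λs r * G r j * v j)    ≈⟨ ∑-comm (λ j r → λs r * G r j * v j) ⟩
    ∑[ r < k ] ∑[ j < n ] (λs r * G r j * v j)    ≈⟨ sum-cong-≋ (λ r → sum-cong-≋ (λ j → *-assoc (λs r) (G r j) (v j))) ⟩
    ∑[ r < k ] ∑[ j < n ] (λs r * (G r j * v j))  ≈⟨ sum-cong-≋ (λ r → *-distribˡ-sum (λs r) (λ j → G r j * v j)) ⟨
    ∑[ r < k ] (λs r * ∑[ j < n ] (G r j * v j))  ≈⟨ sum-cong-≋ (λ r → trans (*-congˡ (G⊥v′ r)) (zeroʳ (λs r))) ⟩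
    ∑[ r < k ] 0#                                 ≈⟨ sum-replicate-zero k ⟩
    0#                                            ∎
    where
    u≈∑ : ∀ j → u j ≈ ∑[ r < k ] (λs r * G r j)
    u≈∑ j = trans (u≈Σ j) (reflexive (Σ≡sum (λ r → λs r * G r j)))

    G⊥v′ : ∀ r → ∑[ j < n ] (G r j * v j) ≈ 0#
    G⊥v′ r = trans (reflexive (≡.sym (Σ≡sum (λ j → G r j * v j)))) (G⊥v r)

  rowsOrthogonal⇒selfOrthogonal : ∀ {k n} (G : Fin k → Fin n → Carrier) →
    (∀ r s → ⟨_,_⟩ F (G r) (G s) ≈ 0#) → RowSpanSelfOrthogonal F G
  rowsOrthogonal⇒selfOrthogonal G G⊥G u v u∈C v∈C = ⟨⟩-rowSpan G u∈C (λ r →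
    trans (⟨⟩-comm (G r) v) (⟨⟩-rowSpan G v∈C (λ s → G⊥G s r)))

  ι-rowsSelfOrthogonal : ∀ {p k n} (A : Fin k → Fin n → ℕ) → ι F p ≈ 0# →
    (∀ r s → p ∣ ℕΣ.sum (λ j → A r j *ℕ A s j)) → RowSpanSelfOrthogonal F (λ r j → ι F (A r j))
  ι-rowsSelfOrthogonal {n = n} A ιp≈0 p∣AAᵀ = rowsOrthogonal⇒selfOrthogonal _ λ r s → begin
    ⟨_,_⟩ F (λ j → ι F (A r j)) (λ j → ι F (A s j))  ≡⟨ Σ≡sum (λ j → ι F (A r j) * ι F (A s j)) ⟩
    ∑[ j < n ] (ι F (A r j) * ι F (A s j))          ≈⟨ sum-cong-≋ (λ j → ι-homo-* (A r j) (A s j)) ⟨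
    ∑[ j < n ] ι F (A r j *ℕ A s j)                  ≈⟨ ι-homo-∑ (λ j → A r j *ℕ A s j) ⟨
    ι F (ℕΣ.sum (λ j → A r j *ℕ A s j))              ≈⟨ ι-∣ ιp≈0 (p∣AAᵀ r s) ⟩
    0#                                               ∎

  module _ {q} (card : HasCardinality F q) where
    open HasCardinality card

    index : Carrier → Fin q
    index x = proj₁ (surjective x)

    enum∘index : ∀ x → enum (index x) ≈ x
    enum∘index x = proj₂ (surjective x)

    ≈-decidable : ∀ x y → Dec (x ≈ y)
    ≈-decidable x y = map′
      (λ eq → trans (sym (enum∘index x)) (trans (reflexive (≡.cong enum eq)) (enum∘index y)))
      (λ x≈y → injective _ _ (trans (enum∘index x) (trans x≈y (sym (enum∘index y)))))
      (index x ≟ᶠ index y)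

    +-translation : Carrier → Permutation′ q
    +-translation t = permutation (λ i → index (enum i + t)) (λ i → index (enum i - t))
      (λ i → injective _ _ (begin
        enum (index (enum (index (enum i - t)) + t))  ≈⟨ enum∘index _ ⟩
        enum (index (enum i - t)) + t                 ≈⟨ +-congʳ (enum∘index _) ⟩
        enum i - t + t                                ≈⟨ +-assoc _ _ _ ⟩
        enum i + (- t + t)                            ≈⟨ +-congˡ (-‿inverseˡ t) ⟩
        enum i + 0#                                   ≈⟨ +-identityʳ _ ⟩
        enum i                                        ∎))
      (λ i → injective _ _ (begin
        enum (index (enum (index (enum i + t)) - t))  ≈⟨ enum∘index _ ⟩
        enum (index (enum i + t)) - t                 ≈⟨ +-congʳ (enum∘index _) ⟩
        enum i + t - t                                ≈⟨ +-assoc _ _ _ ⟩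
        enum i + (t - t)                              ≈⟨ +-congˡ (-‿inverseʳ t) ⟩
        enum i + 0#                                   ≈⟨ +-identityʳ _ ⟩
        enum i                                        ∎))

    -- Translation by 1 permutes F, so Σ F ≈ Σ F + q·1.
    ι-card≈0 : ι F q ≈ 0#
    ι-card≈0 = identityʳ-unique T (ι F q) (sym (begin
      T                                    ≈⟨ ∑-permute enum (+-translation 1#) ⟩
      ∑[ i < q ] enum (index (enum i + 1#)) ≈⟨ sum-cong-≋ (λ i → enum∘index (enum i + 1#)) ⟩
      ∑[ i < q ] (enum i + 1#)             ≈⟨ ∑-distrib-+ enum (λ _ → 1#) ⟩
      T + ∑[ i < q ] 1#                    ≈⟨ +-congˡ (sum-replicate q) ⟩
      T + q × 1#                           ≡⟨ ≡.cong (T +_) (≡.sym (ι≡×1# q)) ⟩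
      T + ι F q                            ∎))
      where T = sum enum

  module _ (field′ : IsField F) where
    open IsField field′

    nonzero-*-cancelˡ : ∀ {x y} → ¬ x ≈ 0# → x * y ≈ 0# → y ≈ 0#
    nonzero-*-cancelˡ {x} {y} x≉0 xy≈0 with inverse x x≉0
    ... | x⁻¹ , xx⁻¹≈1 = begin
      y                ≈⟨ *-identityˡ y ⟨
      1# * y           ≈⟨ *-congʳ (trans (sym xx⁻¹≈1) (*-comm x x⁻¹)) ⟩
      x⁻¹ * x * y      ≈⟨ *-assoc x⁻¹ x y ⟩
      x⁻¹ * (x * y)    ≈⟨ *-congˡ xy≈0 ⟩
      x⁻¹ * 0#         ≈⟨ zeroʳ x⁻¹ ⟩
      0#               ∎

    ι-^-nonzero : ∀ {p} → ¬ ι F p ≈ 0# → ∀ k → ¬ ι F (p ^ k) ≈ 0#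
    ι-^-nonzero ιp≉0 zero    ι1≈0 = 1≉0 (trans (sym (+-identityʳ 1#)) ι1≈0)
    ι-^-nonzero {p} ιp≉0 (suc k) ιpᵏ⁺¹≈0 =
      ι-^-nonzero ιp≉0 k (nonzero-*-cancelˡ ιp≉0 (trans (sym (ι-homo-* p (p ^ k))) ιpᵏ⁺¹≈0))

    -- Constructively, ι p ≈ 0 is read off from ι (p ^ m) ≈ 0 only because ≈ is decidable on a finite F.
    ι-char≈0 : ∀ {p m} → HasCardinality F (p ^ m) → ι F p ≈ 0#
    ι-char≈0 {p} {m} card with ≈-decidable card (ι F p) 0#
    ... | yes ιp≈0 = ιp≈0
    ... | no  ιp≉0 = ⊥-elim (ι-^-nonzero ιp≉0 m (ι-card≈0 card))

module Counting where
  open import Data.Nat using (zero; _+_; _*_; _<_; >-nonZero; >-nonZero⁻¹)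
  open import Data.Nat.Properties using (+-*-semiring; *-commutativeSemigroup; *-comm; *-cancelˡ-≡; +-identityʳ; *-identityˡ; *-assoc)
  open import Data.Nat.Divisibility using (_∣0; ∣m∣n⇒∣m+n; ∣m⇒∣m*n)
  open import Data.Fin using (_≟_)
  open import Data.List using (_∷_; length; filter; tabulate; allFin)
  open import Data.List.Properties using (filter-some)
  open import Data.List.Membership.Propositional using (_∈_; lose)
  open import Data.List.Membership.Propositional.Properties using (∈-filter⁻; ∈-allFin)
  open import Data.List.Relation.Unary.Any using (here)
  open import Data.Product using (Σ; _,_; proj₂)
  open import Relation.Nullary using (Dec; yes; no)
  open import Relation.Nullary.Decidable using (_×-dec_)
  open import Relation.Unary using (Pred; Decidable)
  open import Relation.Binary.PropositionalEquality using (_≡_; refl; sym; trans; cong; cong₂; subst; module ≡-Reasoning)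
  open import Algebra.Properties.CommutativeSemigroup *-commutativeSemigroup using (x∙yz≈z∙yx)
  open import Algebra.Properties.Semiring.Sum +-*-semiring

  [_] : ∀ {p} {P : Set p} → Dec P → ℕ
  [ yes _ ] = 1
  [ no _ ] = 0

  [×-dec] : ∀ {p q} {P : Set p} {Q : Set q} (P? : Dec P) (Q? : Dec Q) →
            [ P? ×-dec Q? ] ≡ [ P? ] * [ Q? ]
  [×-dec] (yes _) (yes _) = refl
  [×-dec] (yes _) (no _)  = refl
  [×-dec] (no _)  _       = refl

  length-filter-tabulate : ∀ {a ℓ n} {A : Set a} {P : Pred A ℓ} (P? : Decidable P) (f : Fin n → A) →
                           length (filter P? (tabulate f)) ≡ ∑[ j < n ] [ P? (f j) ]
  length-filter-tabulate {n = zero}  P? f = refl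
  length-filter-tabulate {n = suc n} P? f with P? (f zero)
  ... | yes _ = cong suc (length-filter-tabulate P? (λ j → f (suc j)))
  ... | no _  = length-filter-tabulate P? (λ j → f (suc j))

  count≡∑ : ∀ {N ℓ} {P : Pred (Fin N) ℓ} (P? : Decidable P) → count P? ≡ ∑[ z < N ] [ P? z ]
  count≡∑ P? = length-filter-tabulate P? (λ z → z)

  count>0⇒∃ : ∀ {N ℓ} {P : Pred (Fin N) ℓ} (P? : Decidable P) → 0 < count P? → Σ (Fin N) P
  count>0⇒∃ {N} P? pos with filter P? (allFin N) in eq
  ... | y ∷ _ = y , proj₂ (∈-filter⁻ P? {xs = allFin N} (subst (y ∈_) (sym eq) (here refl)))

  [suc≟suc] : ∀ {n} (u j : Fin n) → [ suc u ≟ suc j ] ≡ [ u ≟ j ]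
  [suc≟suc] u j with u ≟ j
  ... | yes _ = refl
  ... | no _  = refl

  ∑-δ : ∀ {n} (u : Fin n) (g : Fin n → ℕ) → ∑[ b < n ] ([ u ≟ b ] * g b) ≡ g u
  ∑-δ {suc n} zero    g = trans (cong₂ _+_ (*-identityˡ (g zero)) (sum-replicate-zero n)) (+-identityʳ (g zero))
  ∑-δ {suc n} (suc u) g = trans (sum-cong-≗ (λ j → cong (_* g (suc j)) ([suc≟suc] u j)))
                                (∑-δ u (λ j → g (suc j)))

  [≟]-* : ∀ {n} (u a : Fin n) (g : Fin n → ℕ) → [ u ≟ a ] * g u ≡ [ u ≟ a ] * g a
  [≟]-* u a g with u ≟ a
  ... | yes refl = refl
  ... | no _     = refl

  ∣-∑ : ∀ {d n} (f : Fin n → ℕ) → (∀ j → d ∣ f j) → d ∣ ∑[ j < n ] f j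
  ∣-∑ {n = zero}  f d∣f = _ ∣0
  ∣-∑ {n = suc n} f d∣f = ∣m∣n⇒∣m+n (d∣f zero) (∣-∑ (λ j → f (suc j)) (λ j → d∣f (suc j)))

  ∑-*-assoc : ∀ {m n} (f : Fin m → ℕ) (g : Fin m → Fin n → ℕ) (h : Fin n → ℕ) →
              ∑[ b < n ] (∑[ z < m ] (f z * g z b) * h b) ≡ ∑[ z < m ] (f z * ∑[ b < n ] (g z b * h b))
  ∑-*-assoc {m} {n} f g h = begin
    ∑[ b < n ] (∑[ z < m ] (f z * g z b) * h b)   ≡⟨ sum-cong-≗ (λ b → *-distribʳ-sum (h b) (λ z → f z * g z b)) ⟩
    ∑[ b < n ] ∑[ z < m ] (f z * g z b * h b)     ≡⟨ ∑-comm (λ b z → f z * g z b * h b) ⟩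
    ∑[ z < m ] ∑[ b < n ] (f z * g z b * h b)     ≡⟨ sum-cong-≗ (λ z → sum-cong-≗ (λ b → *-assoc (f z) (g z b) (h b))) ⟩
    ∑[ z < m ] ∑[ b < n ] (f z * (g z b * h b))   ≡⟨ sum-cong-≗ (λ z → *-distribˡ-sum (f z) (λ b → g z b * h b)) ⟨
    ∑[ z < m ] (f z * ∑[ b < n ] (g z b * h b))   ∎
    where open ≡-Reasoning

  count>0 : ∀ {N ℓ} {P : Pred (Fin N) ℓ} (P? : Decidable P) {x} → P x → 0 < count P?
  count>0 {N} P? {x} px = filter-some P? (lose (∈-allFin x) px)

  cellSize-nonZero : ∀ {N n} (Π : Fin N → Fin n) {c} → AllCellsOfSize N n Π c → Fin N → NonZero c
  cellSize-nonZero Π cells x = >-nonZero (subst (0 <_) (cells (Π x)) (count>0 (λ z → Π z ≟ Π x) refl))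

  module QuotientMatrices {N d n} (R : Fin N → Fin N → Fin (suc d)) (Π : Fin N → Fin n)
    (M : Fin (suc d) → Fin n → Fin n → ℕ) (equitable : IsEquitableWithQuotients N d n R Π M) where
    open ≡-Reasoning

    M-as-∑ : ∀ i x b → M i (Π x) b ≡ ∑[ z < N ] ([ R x z ≟ i ] * [ Π z ≟ b ])
    M-as-∑ i x b = begin
      M i (Π x) b                                      ≡⟨ equitable i x b ⟨
      count (λ z → (R x z ≟ i) ×-dec (Π z ≟ b))        ≡⟨ count≡∑ (λ z → (R x z ≟ i) ×-dec (Π z ≟ b)) ⟩
      ∑[ z < N ] [ (R x z ≟ i) ×-dec (Π z ≟ b) ]        ≡⟨ sum-cong-≗ (λ z → [×-dec] (R x z ≟ i) (Π z ≟ b)) ⟩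
      ∑[ z < N ] ([ R x z ≟ i ] * [ Π z ≟ b ])         ∎

    -- The Γ_i-edges from cell a to cell b; counted from either end this is c · M i a b or c · M i b a.
    cellEdges : Fin (suc d) → Fin n → Fin n → ℕ
    cellEdges i a b = ∑[ x < N ] ∑[ z < N ] ([ Π x ≟ a ] * ([ R x z ≟ i ] * [ Π z ≟ b ]))

    cellEdges≡c*M : ∀ {c} → AllCellsOfSize N n Π c → ∀ i a b → cellEdges i a b ≡ c * M i a b
    cellEdges≡c*M {c} cells i a b = begin
      cellEdges i a b
        ≡⟨ sum-cong-≗ (λ x → *-distribˡ-sum [ Π x ≟ a ] (λ z → [ R x z ≟ i ] * [ Π z ≟ b ])) ⟨
      ∑[ x < N ] ([ Π x ≟ a ] * ∑[ z < N ] ([ R x z ≟ i ] * [ Π z ≟ b ]))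
        ≡⟨ sum-cong-≗ (λ x → cong ([ Π x ≟ a ] *_) (M-as-∑ i x b)) ⟨
      ∑[ x < N ] ([ Π x ≟ a ] * M i (Π x) b)
        ≡⟨ sum-cong-≗ (λ x → [≟]-* (Π x) a (λ a′ → M i a′ b)) ⟩
      ∑[ x < N ] ([ Π x ≟ a ] * M i a b)
        ≡⟨ *-distribʳ-sum (M i a b) (λ x → [ Π x ≟ a ]) ⟨
      ∑[ x < N ] [ Π x ≟ a ] * M i a b
        ≡⟨ cong (_* M i a b) (trans (sym (cells a)) (count≡∑ (λ x → Π x ≟ a))) ⟨
      c * M i a b ∎

    cellEdges-sym : (∀ x y → R x y ≡ R y x) → ∀ i a b → cellEdges i a b ≡ cellEdges i b a
    cellEdges-sym R-sym i a b = trans (∑-comm (λ x z → [ Π x ≟ a ] * ([ R x z ≟ i ] * [ Π z ≟ b ])))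
      (sum-cong-≗ λ z → sum-cong-≗ λ x → begin
        [ Π x ≟ a ] * ([ R x z ≟ i ] * [ Π z ≟ b ])  ≡⟨ x∙yz≈z∙yx [ Π x ≟ a ] [ R x z ≟ i ] [ Π z ≟ b ] ⟩
        [ Π z ≟ b ] * ([ R x z ≟ i ] * [ Π x ≟ a ])  ≡⟨ cong (λ k → [ Π z ≟ b ] * ([ k ≟ i ] * [ Π x ≟ a ])) (R-sym x z) ⟩
        [ Π z ≟ b ] * ([ R z x ≟ i ] * [ Π x ≟ a ])  ∎)

    M-sym : ∀ {c} .{{_ : NonZero c}} → AllCellsOfSize N n Π c → (∀ x y → R x y ≡ R y x) →
            ∀ i a b → M i a b ≡ M i b a
    M-sym {c} cells R-sym i a b = *-cancelˡ-≡ (M i a b) (M i b a) c (begin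
      c * M i a b      ≡⟨ cellEdges≡c*M cells i a b ⟨
      cellEdges i a b  ≡⟨ cellEdges-sym R-sym i a b ⟩
      cellEdges i b a  ≡⟨ cellEdges≡c*M cells i b a ⟩
      c * M i b a      ∎)

    module _ (pp : Fin (suc d) → Fin (suc d) → Fin (suc d) → ℕ)
      (intersection : ∀ i j x y → count (λ z → (R x z ≟ i) ×-dec (R z y ≟ j)) ≡ pp i j (R x y)) where

      MM≡∑p-over-cell : ∀ i j x s →
        ∑[ b < n ] (M i (Π x) b * M j b s) ≡ ∑[ w < N ] (pp i j (R x w) * [ Π w ≟ s ])
      MM≡∑p-over-cell i j x s = begin
        ∑[ b < n ] (M i (Π x) b * M j b s)
          ≡⟨ sum-cong-≗ (λ b → cong (_* M j b s) (M-as-∑ i x b)) ⟩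
        ∑[ b < n ] (∑[ z < N ] ([ R x z ≟ i ] * [ Π z ≟ b ]) * M j b s)
          ≡⟨ ∑-*-assoc (λ z → [ R x z ≟ i ]) (λ z b → [ Π z ≟ b ]) (λ b → M j b s) ⟩
        ∑[ z < N ] ([ R x z ≟ i ] * ∑[ b < n ] ([ Π z ≟ b ] * M j b s))
          ≡⟨ sum-cong-≗ (λ z → cong ([ R x z ≟ i ] *_) (trans (∑-δ (Π z) (λ b → M j b s)) (M-as-∑ j z s))) ⟩
        ∑[ z < N ] ([ R x z ≟ i ] * ∑[ w < N ] ([ R z w ≟ j ] * [ Π w ≟ s ]))
          ≡⟨ ∑-*-assoc (λ z → [ R x z ≟ i ]) (λ z w → [ R z w ≟ j ]) (λ w → [ Π w ≟ s ]) ⟨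
        ∑[ w < N ] (∑[ z < N ] ([ R x z ≟ i ] * [ R z w ≟ j ]) * [ Π w ≟ s ])
          ≡⟨ sum-cong-≗ (λ w → cong (_* [ Π w ≟ s ]) (paths w)) ⟩
        ∑[ w < N ] (pp i j (R x w) * [ Π w ≟ s ]) ∎
        where
        paths : ∀ w → ∑[ z < N ] ([ R x z ≟ i ] * [ R z w ≟ j ]) ≡ pp i j (R x w)
        paths w = begin
          ∑[ z < N ] ([ R x z ≟ i ] * [ R z w ≟ j ])  ≡⟨ sum-cong-≗ (λ z → [×-dec] (R x z ≟ i) (R z w ≟ j)) ⟨
          ∑[ z < N ] [ (R x z ≟ i) ×-dec (R z w ≟ j) ] ≡⟨ count≡∑ (λ z → (R x z ≟ i) ×-dec (R z w ≟ j)) ⟨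
          count (λ z → (R x z ≟ i) ×-dec (R z w ≟ j))  ≡⟨ intersection i j x w ⟩
          pp i j (R x w)                               ∎

      MM≡∑pM : ∀ i j x s → ∑[ b < n ] (M i (Π x) b * M j b s) ≡ ∑[ k < suc d ] (pp i j k * M k (Π x) s)
      MM≡∑pM i j x s = begin
        ∑[ b < n ] (M i (Π x) b * M j b s)          ≡⟨ MM≡∑p-over-cell i j x s ⟩
        ∑[ w < N ] (pp i j (R x w) * [ Π w ≟ s ])   ≡⟨ sum-cong-≗ (λ w → cong (_* [ Π w ≟ s ]) (expand w)) ⟨
        ∑[ w < N ] (∑[ k < suc d ] (pp i j k * [ R x w ≟ k ]) * [ Π w ≟ s ])
                                                    ≡⟨ ∑-*-assoc (pp i j) (λ k w → [ R x w ≟ k ]) (λ w → [ Π w ≟ s ]) ⟩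
        ∑[ k < suc d ] (pp i j k * ∑[ w < N ] ([ R x w ≟ k ] * [ Π w ≟ s ]))
                                                    ≡⟨ sum-cong-≗ (λ k → cong (pp i j k *_) (M-as-∑ k x s)) ⟨
        ∑[ k < suc d ] (pp i j k * M k (Π x) s)     ∎
        where
        expand : ∀ w → ∑[ k < suc d ] (pp i j k * [ R x w ≟ k ]) ≡ pp i j (R x w)
        expand w = trans (sum-cong-≗ (λ k → *-comm (pp i j k) [ R x w ≟ k ])) (∑-δ (R x w) (pp i j))

      p∣MM : ∀ {c} .{{_ : NonZero c}} → AllCellsOfSize N n Π c → ∀ {p} i j → (∀ k → p ∣ pp i j k) →
             ∀ r s → p ∣ ∑[ b < n ] (M i r b * M j b s)
      p∣MM {c} cells {p} i j p∣pp r s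
        with count>0⇒∃ (λ z → Π z ≟ r) (subst (0 <_) (sym (cells r)) (>-nonZero⁻¹ c))
      ... | x , refl =
        subst (p ∣_) (sym (MM≡∑pM i j x s)) (∣-∑ _ (λ k → ∣m⇒∣m*n (M k (Π x) s) (p∣pp k)))

      p∣rowProducts : ∀ {c} .{{_ : NonZero c}} → AllCellsOfSize N n Π c → (∀ x y → R x y ≡ R y x) →
                      ∀ {p} i → (∀ k → p ∣ pp i i k) → ∀ r s → p ∣ ∑[ j < n ] (M i r j * M i s j)
      p∣rowProducts cells R-sym {p} i p∣pp r s =
        subst (p ∣_) (sum-cong-≗ λ j → cong (M i r j *_) (M-sym cells R-sym i j s))
              (p∣MM cells i i p∣pp r s)

theorem3p2 : (N d n : ℕ) .{{_ : NonZero N}}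
    (R : Fin N → Fin N → Fin (suc d))
    (pp : Fin (suc d) → Fin (suc d) → Fin (suc d) → ℕ)
    → IsAssociationScheme N d R pp
    → (Π : Fin N → Fin n) (M : Fin (suc d) → Fin n → Fin n → ℕ)
    → IsEquitableWithQuotients N d n R Π M
    → (c : ℕ) → AllCellsOfSize N n Π c
    → (p : ℕ) → Prime p
    → (i : Fin d)
    → (∀ k → p ∣ pp (suc i) (suc i) k)
    → (m : ℕ) .{{_ : NonZero m}}
    → {a ℓ : Level} (F : CommutativeRing a ℓ)
    → IsField F → HasCardinality F (p ^ m)
    → RowSpanSelfOrthogonal F (λ r s → ι F (M (suc i) r s))
theorem3p2 (suc N) d n R pp scheme Π M equitable c cells p _ i p∣pᵢᵢ m F isField card =
  ι-rowsSelfOrthogonal (M (suc i)) (ι-char≈0 isField {p} {m} card)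
    (p∣rowProducts pp intersection {{cellSize-nonZero Π cells zero}} cells symmetric (suc i) p∣pᵢᵢ)
  where
  open IsAssociationScheme scheme
  open Counting using (cellSize-nonZero)
  open Counting.QuotientMatrices R Π M equitable using (p∣rowProducts)
  open FiniteFieldCodes F using (ι-rowsSelfOrthogonal; ι-char≈0)
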